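{- For every integer $k\ge2$, $$\sum_{n\ge1}x^n\sum_{w\in\mathcal F_{n,k}}\deg_2(G(w))=\frac{2\left(4x-7x^2-2x^k+x^{k+1}+7x^{k+2}-x^{2k+1}-2x^{2k+2}\right)}{(1-2x+x^{k+1})^2}.$$
   Context: For integers $k\ge 2$, $n\ge1$, $\mathcal F_{n,k}$ is the set of binary words $w=w_1\cdots w_n$ with no $k$ consecutive $1$'s. $P(w)$ is the bargraph polyomino formed by the unit squares $[i-1,i]\times[j-1,j]$, $1\le i\le n$, $1\le j\le w_i+1$. $G(w)$ is the graph whose vertices are the corners of the cells of $P(w)$ and whose edges are the cell sides. $\deg_i(G)$ is the number of vertices of degree $i$ in $G$. -}

module Defs where

open import Data.Bool using (Bool; true; false; _∧_; _∨_; not; if_then_else_)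
open import Data.Nat using (ℕ; zero; suc; _+_; _∸_; _≤ᵇ_; _<ᵇ_; _≡ᵇ_)
open import Data.Nat.ListAction using (sum)
open import Data.List using (List; []; _∷_; map; _++_; length; upTo; filterᵇ; concatMap)
open import Data.Integer as ℤ using (ℤ)

wordsOfLength : ℕ → List (List Bool)
wordsOfLength zero    = [] ∷ []
wordsOfLength (suc n) = map (false ∷_) (wordsOfLength n) ++ map (true ∷_) (wordsOfLength n)

leadingOnes : List Bool → ℕ
leadingOnes (true ∷ w) = suc (leadingOnes w)
leadingOnes _          = 0

hasRun : ℕ → List Bool → Bool
hasRun k []      = k ≤ᵇ 0
hasRun k (b ∷ w) = (k ≤ᵇ leadingOnes (b ∷ w)) ∨ hasRun k w

F : ℕ → ℕ → List (List Bool)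
F n k = filterᵇ (λ w → not (hasRun k w)) (wordsOfLength n)

bit : Bool → ℕ
bit true  = 1
bit false = 0

-- w_{i+1} as a natural number (0-indexed access)
letter : List Bool → ℕ → ℕ
letter []      _       = 0
letter (b ∷ w) zero    = bit b
letter (b ∷ w) (suc i) = letter w i

-- cell i j : the unit square [i-1,i]×[j-1,j] belongs to P(w),
-- i.e. 1 ≤ i ≤ n and 1 ≤ j ≤ w_i + 1
cell : List Bool → ℕ → ℕ → Bool
cell w zero    _       = false
cell w (suc i) zero    = false
cell w (suc i) (suc j) = (i <ᵇ length w) ∧ (j ≤ᵇ letter w i)

corner : List Bool → ℕ → ℕ → Bool
corner w a b = cell w a b ∨ cell w (suc a) b ∨ cell w a (suc b) ∨ cell w (suc a) (suc b)

-- the horizontal unit segment (a,b)–(a+1,b) is a side of some cell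
hEdge : List Bool → ℕ → ℕ → Bool
hEdge w a b = cell w (suc a) b ∨ cell w (suc a) (suc b)

-- the vertical unit segment (a,b)–(a,b+1) is a side of some cell
vEdge : List Bool → ℕ → ℕ → Bool
vEdge w a b = cell w a (suc b) ∨ cell w (suc a) (suc b)

leftEdge : List Bool → ℕ → ℕ → ℕ
leftEdge w zero    b = 0
leftEdge w (suc a) b = bit (hEdge w a b)

downEdge : List Bool → ℕ → ℕ → ℕ
downEdge w a zero    = 0
downEdge w a (suc b) = bit (vEdge w a b)

degree : List Bool → ℕ → ℕ → ℕ
degree w a b = bit (hEdge w a b) + leftEdge w a b + bit (vEdge w a b) + downEdge w a b

-- All corners (a,b) satisfy
-- 0 ≤ a ≤ n and 0 ≤ b ≤ 2 (since w_i + 1 ≤ 2), so we range over the box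
-- 0 ≤ a ≤ n, 0 ≤ b ≤ 3 and keep the points that are corners (= vertices).
degCount : ℕ → List Bool → ℕ
degCount i w = sum (concatMap (λ a → map (λ b → bit (corner w a b ∧ (degree w a b ≡ᵇ i))) (upTo 4))
                              (upTo (suc (length w))))

seriesCoeff : ℕ → ℕ → ℤ
seriesCoeff k zero    = ℤ.0ℤ
seriesCoeff k (suc m) = ℤ.+ (sum (map (degCount 2) (F (suc m) k)))

Series : Set
Series = ℕ → ℤ

mono : ℤ → ℕ → Series
mono c e n = if n ≡ᵇ e then c else ℤ.0ℤ

infixl 6 _⊕_
_⊕_ : Series → Series → Series
(f ⊕ g) n = f n ℤ.+ g n

sumℤ : List ℤ → ℤ
sumℤ []       = ℤ.0ℤ
sumℤ (x ∷ xs) = x ℤ.+ sumℤ xs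

infixl 7 _⊛_
_⊛_ : Series → Series → Series
(f ⊛ g) n = sumℤ (map (λ i → f i ℤ.* g (n ∸ i)) (upTo (suc n)))

den : ℕ → Series
den k = mono (ℤ.+ 1) 0 ⊕ mono (ℤ.- ℤ.+ 2) 1 ⊕ mono (ℤ.+ 1) (suc k)

num : ℕ → Series
num k = mono (ℤ.+ 8) 1 ⊕ mono (ℤ.- ℤ.+ 14) 2 ⊕ mono (ℤ.- ℤ.+ 4) k
      ⊕ mono (ℤ.+ 2) (k + 1) ⊕ mono (ℤ.+ 14) (k + 2)
      ⊕ mono (ℤ.- ℤ.+ 2) (k + k + 1) ⊕ mono (ℤ.- ℤ.+ 4) (k + k + 2)

{-# OPTIONS --safe #-}
-- For a nonempty word w, deg₂(G(w)) = 4 + (number of letter changes in w).  Sorting words by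
-- their first letter, and the words starting with k − 1 ones by what follows that block, gives
-- linear recurrences for the number A_n of words in F_{n,k} and for their total weight
-- E_n = Σ (4 + changes).  With D = 1 − 2x + x^{k+1} they read D·A = 1 − x^k and
-- D·(E − 4) = W, where W = (x − 2x^{k+1} + x^{k+2}) A + 7x − 4x^k − 3x^{k+1}.
-- Multiplying W by D once more and using D·A = 1 − x^k leaves the stated numerator.
module Submission where

open import Defs
open import Data.Nat using (ℕ; _≤_)
open import Relation.Binary.PropositionalEquality using (_≡_)

module DegreeTwo where

  open import Data.Bool using (Bool; true; false; _∧_; _xor_)
  open import Data.Nat using (ℕ; suc; _+_; _≡ᵇ_)
  open import Data.Nat.Properties using (+-assoc; +-identityʳ)
  open import Data.Nat.ListAction using (sum)
  open import Data.Nat.ListAction.Properties using (sum-++)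
  open import Data.Nat.Tactic.RingSolver using (solve-∀)
  open import Data.List using (List; []; _∷_; map; length; upTo; applyUpTo; concatMap)
  open import Data.List.Properties using (map-applyUpTo)
  open import Relation.Binary.PropositionalEquality

  changes : List Bool → ℕ
  changes (b ∷ c ∷ w) = bit (b xor c) + changes (c ∷ w)
  changes _           = 0

  sum-concatMap : ∀ {A : Set} (f : A → List ℕ) xs →
                  sum (concatMap f xs) ≡ sum (map (λ x → sum (f x)) xs)
  sum-concatMap f []       = refl
  sum-concatMap f (x ∷ xs) = trans (sum-++ (f x) _) (cong (sum (f x) +_) (sum-concatMap f xs))

  degree2Column : List Bool → ℕ → ℕ
  degree2Column w a = sum (map (λ b → bit (corner w a b ∧ (degree w a b ≡ᵇ 2))) (upTo 4))

  degCount2-columns : ∀ w → degCount 2 w ≡ sum (applyUpTo (degree2Column w) (suc (length w)))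
  degCount2-columns w =
    trans (sum-concatMap (λ a → map (λ b → bit (corner w a b ∧ (degree w a b ≡ᵇ 2))) (upTo 4))
                         (upTo (suc (length w))))
          (cong sum (map-applyUpTo (λ a → a) (degree2Column w) (suc (length w))))

  -- Column a + 2 of b ∷ c ∷ w is column a + 1 of c ∷ w, so only these two columns differ.
  first-columns : ∀ b c w → degree2Column (b ∷ c ∷ w) 0 + degree2Column (b ∷ c ∷ w) 1
                              ≡ degree2Column (c ∷ w) 0 + bit (b xor c)
  first-columns false false w = refl
  first-columns false true  w = refl
  first-columns true  false w = refl
  first-columns true  true  w = refl

  single-columns : ∀ b → degree2Column (b ∷ []) 0 + degree2Column (b ∷ []) 1 ≡ 4
  single-columns false = refl
  single-columns true  = refl

  degCount2-cons : ∀ b w → degCount 2 (b ∷ w) ≡ 4 + changes (b ∷ w)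
  degCount2-cons b [] = trans (degCount2-columns (b ∷ []))
    (trans (cong (degree2Column (b ∷ []) 0 +_) (+-identityʳ (degree2Column (b ∷ []) 1))) (single-columns b))
  degCount2-cons b (c ∷ w) = begin
    degCount 2 (b ∷ c ∷ w)                           ≡⟨ degCount2-columns (b ∷ c ∷ w) ⟩
    col₀ + (col₁ + rest)                            ≡⟨ sym (+-assoc col₀ col₁ rest) ⟩
    (col₀ + col₁) + rest                            ≡⟨ cong (_+ rest) (first-columns b c w) ⟩
    (degree2Column (c ∷ w) 0 + bit (b xor c)) + rest ≡⟨ regroup (degree2Column (c ∷ w) 0) (bit (b xor c)) rest ⟩
    bit (b xor c) + (degree2Column (c ∷ w) 0 + rest) ≡⟨ cong (bit (b xor c) +_) (trans (sym (degCount2-columns (c ∷ w))) (degCount2-cons c w)) ⟩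
    bit (b xor c) + (4 + changes (c ∷ w))            ≡⟨ regroup′ (bit (b xor c)) (changes (c ∷ w)) ⟩
    4 + changes (b ∷ c ∷ w)                          ∎
    where
    open ≡-Reasoning
    col₀ col₁ rest : ℕ
    col₀ = degree2Column (b ∷ c ∷ w) 0
    col₁ = degree2Column (b ∷ c ∷ w) 1
    rest = sum (applyUpTo (λ a → degree2Column (c ∷ w) (suc a)) (suc (length w)))
    regroup : ∀ x y z → (x + y) + z ≡ y + (x + z)
    regroup = solve-∀
    regroup′ : ∀ x y → x + (4 + y) ≡ 4 + (x + y)
    regroup′ = solve-∀

module PowerSeries where

  open import Data.Bool using (true; false)
  open import Data.Nat as ℕ using (ℕ; zero; suc; _∸_; _≡ᵇ_; _<_; z≤n; s≤s; _≤?_)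
  import Data.Nat.Properties as ℕ
  open import Data.Integer using (ℤ; +_; 0ℤ; _+_; _*_; -_; _-_)
  open import Data.Integer.Properties
    using (+-identityˡ; +-identityʳ; +-assoc; *-identityˡ; *-identityʳ; *-zeroʳ; *-assoc; *-distribˡ-+; *-distribʳ-+)
  open import Data.Integer.Tactic.RingSolver using (solve-∀)
  open import Data.List using (List; []; _∷_; map; applyUpTo)
  open import Data.List.Properties using (map-applyUpTo)
  open import Data.Product using (_×_; _,_)
  open import Relation.Binary.PropositionalEquality
  open import Relation.Nullary using (yes; no)

  infixr 7 _∙_

  _∙_ : ℤ → Series → Series
  (c ∙ f) i = c * f i

  δ : ℕ → Series
  δ = mono (+ 1)

  shift : ℕ → Series → Series
  shift zero    f n       = f n
  shift (suc j) f zero    = 0ℤ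
  shift (suc j) f (suc n) = shift j f n

  shift-cong : ∀ {f g} → (∀ i → f i ≡ g i) → ∀ j n → shift j f n ≡ shift j g n
  shift-cong f≗g zero    n       = f≗g n
  shift-cong f≗g (suc j) zero    = refl
  shift-cong f≗g (suc j) (suc n) = shift-cong f≗g j n

  shift-zipWith : ∀ (_∘_ : ℤ → ℤ → ℤ) → 0ℤ ∘ 0ℤ ≡ 0ℤ → ∀ f g j n →
                  shift j (λ i → f i ∘ g i) n ≡ shift j f n ∘ shift j g n
  shift-zipWith _∘_ 0∘0 f g zero    n       = refl
  shift-zipWith _∘_ 0∘0 f g (suc j) zero    = sym 0∘0
  shift-zipWith _∘_ 0∘0 f g (suc j) (suc n) = shift-zipWith _∘_ 0∘0 f g j n

  shift-⊕ : ∀ f g j n → shift j (f ⊕ g) n ≡ shift j f n + shift j g n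
  shift-⊕ = shift-zipWith _+_ refl

  shift-− : ∀ f g j n → shift j (λ i → f i - g i) n ≡ shift j f n - shift j g n
  shift-− = shift-zipWith _-_ refl

  shift-∙ : ∀ c f j n → shift j (c ∙ f) n ≡ c * shift j f n
  shift-∙ c f = shift-zipWith (λ x _ → c * x) (*-zeroʳ c) f f

  shift-shift : ∀ f i j n → shift i (shift j f) n ≡ shift (i ℕ.+ j) f n
  shift-shift f zero    j n       = refl
  shift-shift f (suc i) j zero    = refl
  shift-shift f (suc i) j (suc n) = shift-shift f i j n

  shift-comm : ∀ f i j n → shift i (shift j f) n ≡ shift j (shift i f) n
  shift-comm f i j n = begin
    shift i (shift j f) n ≡⟨ shift-shift f i j n ⟩
    shift (i ℕ.+ j) f n   ≡⟨ cong (λ m → shift m f n) (ℕ.+-comm i j) ⟩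
    shift (j ℕ.+ i) f n   ≡⟨ shift-shift f j i n ⟨
    shift j (shift i f) n ∎
    where open ≡-Reasoning

  shift-shift-suc : ∀ f j n → shift j (shift 1 f) n ≡ shift (suc j) f n
  shift-shift-suc f j n = trans (shift-comm f j 1 n) (shift-shift f 1 j n)

  shift-mono : ∀ c e j n → shift j (mono c e) n ≡ mono c (j ℕ.+ e) n
  shift-mono c e zero    n       = refl
  shift-mono c e (suc j) zero    = refl
  shift-mono c e (suc j) (suc n) = shift-mono c e j n

  shift-δ₀ : ∀ j n → shift j (δ 0) n ≡ δ j n
  shift-δ₀ j n = trans (shift-mono (+ 1) 0 j n) (cong (λ e → δ e n) (ℕ.+-identityʳ j))

  shift-below : ∀ f j n → n < j → shift j f n ≡ 0ℤ
  shift-below f (suc j) zero    _         = refl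
  shift-below f (suc j) (suc n) (s≤s n<j) = shift-below f j n n<j

  shift-+ : ∀ f j n → shift j f (j ℕ.+ n) ≡ f n
  shift-+ f zero    n = refl
  shift-+ f (suc j) n = shift-+ f j n

  mono≡∙δ : ∀ c e n → mono c e n ≡ (c ∙ δ e) n
  mono≡∙δ c e n with n ≡ᵇ e
  ... | true  = sym (*-identityʳ c)
  ... | false = sym (*-zeroʳ c)

  rangeSum : (ℕ → ℤ) → ℕ → ℤ
  rangeSum H m = sumℤ (applyUpTo H m)

  rangeSum-cong : ∀ {H H′} m → (∀ i → i < m → H i ≡ H′ i) → rangeSum H m ≡ rangeSum H′ m
  rangeSum-cong zero    H≗H′ = refl
  rangeSum-cong (suc m) H≗H′ = cong₂ _+_ (H≗H′ 0 (s≤s z≤n)) (rangeSum-cong m (λ i i<m → H≗H′ (suc i) (s≤s i<m)))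

  rangeSum-zero : ∀ {H} m → (∀ i → i < m → H i ≡ 0ℤ) → rangeSum H m ≡ 0ℤ
  rangeSum-zero zero    H≗0 = refl
  rangeSum-zero (suc m) H≗0 = cong₂ _+_ (H≗0 0 (s≤s z≤n)) (rangeSum-zero m (λ i i<m → H≗0 (suc i) (s≤s i<m)))

  rangeSum-+ : ∀ H H′ m → rangeSum (λ i → H i + H′ i) m ≡ rangeSum H m + rangeSum H′ m
  rangeSum-+ H H′ zero    = refl
  rangeSum-+ H H′ (suc m) =
    trans (cong (_+_ (H 0 + H′ 0)) (rangeSum-+ (λ i → H (suc i)) (λ i → H′ (suc i)) m))
          (interchange (H 0) (H′ 0) _ _)
    where
    interchange : ∀ a b c d → a + b + (c + d) ≡ a + c + (b + d)
    interchange = solve-∀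

  rangeSum-* : ∀ c H m → rangeSum (λ i → c * H i) m ≡ c * rangeSum H m
  rangeSum-* c H zero    = sym (*-zeroʳ c)
  rangeSum-* c H (suc m) =
    trans (cong (_+_ (c * H 0)) (rangeSum-* c (λ i → H (suc i)) m)) (sym (*-distribˡ-+ c (H 0) _))

  rangeSum-split : ∀ H a b → rangeSum H (a ℕ.+ b) ≡ rangeSum H a + rangeSum (λ i → H (a ℕ.+ i)) b
  rangeSum-split H zero    b = sym (+-identityˡ _)
  rangeSum-split H (suc a) b =
    trans (cong (_+_ (H 0)) (rangeSum-split (λ i → H (suc i)) a b)) (sym (+-assoc (H 0) _ _))

  ⊛-rangeSum : ∀ f g n → (f ⊛ g) n ≡ rangeSum (λ i → f i * g (n ∸ i)) (suc n)
  ⊛-rangeSum f g n = cong sumℤ (map-applyUpTo (λ i → i) (λ i → f i * g (n ∸ i)) (suc n))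

  ⊛-congˡ : ∀ {f f′} g n → (∀ i → f i ≡ f′ i) → (f ⊛ g) n ≡ (f′ ⊛ g) n
  ⊛-congˡ {f} {f′} g n f≗f′ = begin
    (f ⊛ g) n                                ≡⟨ ⊛-rangeSum f g n ⟩
    rangeSum (λ i → f i * g (n ∸ i)) (suc n)  ≡⟨ rangeSum-cong (suc n) (λ i _ → cong (_* g (n ∸ i)) (f≗f′ i)) ⟩
    rangeSum (λ i → f′ i * g (n ∸ i)) (suc n) ≡⟨ ⊛-rangeSum f′ g n ⟨
    (f′ ⊛ g) n                               ∎
    where open ≡-Reasoning

  ⊛-congʳ : ∀ f {g g′} n → (∀ i → g i ≡ g′ i) → (f ⊛ g) n ≡ (f ⊛ g′) n
  ⊛-congʳ f {g} {g′} n g≗g′ = begin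
    (f ⊛ g) n                                ≡⟨ ⊛-rangeSum f g n ⟩
    rangeSum (λ i → f i * g (n ∸ i)) (suc n)  ≡⟨ rangeSum-cong (suc n) (λ i _ → cong (f i *_) (g≗g′ (n ∸ i))) ⟩
    rangeSum (λ i → f i * g′ (n ∸ i)) (suc n) ≡⟨ ⊛-rangeSum f g′ n ⟨
    (f ⊛ g′) n                               ∎
    where open ≡-Reasoning

  ⊛-distribʳ-⊕ : ∀ f g h n → ((f ⊕ g) ⊛ h) n ≡ (f ⊛ h) n + (g ⊛ h) n
  ⊛-distribʳ-⊕ f g h n = begin
    ((f ⊕ g) ⊛ h) n
      ≡⟨ ⊛-rangeSum (f ⊕ g) h n ⟩
    rangeSum (λ i → (f i + g i) * h (n ∸ i)) (suc n)
      ≡⟨ rangeSum-cong (suc n) (λ i _ → *-distribʳ-+ (h (n ∸ i)) (f i) (g i)) ⟩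
    rangeSum (λ i → f i * h (n ∸ i) + g i * h (n ∸ i)) (suc n)
      ≡⟨ rangeSum-+ (λ i → f i * h (n ∸ i)) (λ i → g i * h (n ∸ i)) (suc n) ⟩
    rangeSum (λ i → f i * h (n ∸ i)) (suc n) + rangeSum (λ i → g i * h (n ∸ i)) (suc n)
      ≡⟨ cong₂ _+_ (⊛-rangeSum f h n) (⊛-rangeSum g h n) ⟨
    (f ⊛ h) n + (g ⊛ h) n
      ∎
    where open ≡-Reasoning

  ⊛-∙ˡ : ∀ c f h n → ((c ∙ f) ⊛ h) n ≡ c * (f ⊛ h) n
  ⊛-∙ˡ c f h n = begin
    ((c ∙ f) ⊛ h) n
      ≡⟨ ⊛-rangeSum (c ∙ f) h n ⟩
    rangeSum (λ i → c * f i * h (n ∸ i)) (suc n)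
      ≡⟨ rangeSum-cong (suc n) (λ i _ → *-assoc c (f i) (h (n ∸ i))) ⟩
    rangeSum (λ i → c * (f i * h (n ∸ i))) (suc n)
      ≡⟨ rangeSum-* c (λ i → f i * h (n ∸ i)) (suc n) ⟩
    c * rangeSum (λ i → f i * h (n ∸ i)) (suc n)
      ≡⟨ cong (c *_) (⊛-rangeSum f h n) ⟨
    c * (f ⊛ h) n
      ∎
    where open ≡-Reasoning

  shift-⊛ : ∀ f h j n → (shift j f ⊛ h) n ≡ shift j (f ⊛ h) n
  shift-⊛ f h j n with j ≤? n
  ... | no  j≰n = trans (⊛-rangeSum (shift j f) h n)
                  (trans (rangeSum-zero (suc n) (λ i i≤n → cong (_* h (n ∸ i)) (shift-below f j i (ℕ.<-≤-trans i≤n (ℕ.≰⇒> j≰n)))))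
                         (sym (shift-below (f ⊛ h) j n (ℕ.≰⇒> j≰n))))
  ... | yes j≤n = subst (λ n → (shift j f ⊛ h) n ≡ shift j (f ⊛ h) n) (ℕ.m+[n∸m]≡n j≤n)
                        (trans (shift-⊛-+ (n ∸ j)) (sym (shift-+ (f ⊛ h) j (n ∸ j))))
    where
    open ≡-Reasoning
    shift-⊛-+ : ∀ m → (shift j f ⊛ h) (j ℕ.+ m) ≡ (f ⊛ h) m
    shift-⊛-+ m = begin
      (shift j f ⊛ h) (j ℕ.+ m)
        ≡⟨ ⊛-rangeSum (shift j f) h (j ℕ.+ m) ⟩
      rangeSum H (suc (j ℕ.+ m))
        ≡⟨ cong (rangeSum H) (ℕ.+-suc j m) ⟨
      rangeSum H (j ℕ.+ suc m)
        ≡⟨ rangeSum-split H j (suc m) ⟩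
      rangeSum H j + rangeSum (λ i → H (j ℕ.+ i)) (suc m)
        ≡⟨ cong₂ _+_ (rangeSum-zero j (λ i i<j → cong (_* h (j ℕ.+ m ∸ i)) (shift-below f j i i<j)))
                     (rangeSum-cong (suc m) (λ i _ → cong₂ _*_ (shift-+ f j i) (cong h (ℕ.[m+n]∸[m+o]≡n∸o j m i)))) ⟩
      0ℤ + rangeSum (λ i → f i * h (m ∸ i)) (suc m)
        ≡⟨ +-identityˡ _ ⟩
      rangeSum (λ i → f i * h (m ∸ i)) (suc m)
        ≡⟨ ⊛-rangeSum f h m ⟨
      (f ⊛ h) m
        ∎
      where
      H : ℕ → ℤ
      H i = shift j f i * h (j ℕ.+ m ∸ i)

  δ₀-⊛ : ∀ h n → (δ 0 ⊛ h) n ≡ h n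
  δ₀-⊛ h n = begin
    (δ 0 ⊛ h) n                                          ≡⟨ ⊛-rangeSum (δ 0) h n ⟩
    + 1 * h n + rangeSum (λ i → δ 0 (suc i) * h (n ∸ suc i)) n ≡⟨ cong (_+_ (+ 1 * h n)) (rangeSum-zero n (λ _ _ → refl)) ⟩
    + 1 * h n + 0ℤ                                       ≡⟨ +-identityʳ _ ⟩
    + 1 * h n                                            ≡⟨ *-identityˡ (h n) ⟩
    h n                                                  ∎
    where open ≡-Reasoning

  mono-⊛ : ∀ c e h n → (mono c e ⊛ h) n ≡ (c ∙ shift e h) n
  mono-⊛ c e h n = begin
    (mono c e ⊛ h) n          ≡⟨ ⊛-congˡ h n (λ i → trans (mono≡∙δ c e i) (cong (c *_) (sym (shift-δ₀ e i)))) ⟩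
    ((c ∙ shift e (δ 0)) ⊛ h) n ≡⟨ ⊛-∙ˡ c (shift e (δ 0)) h n ⟩
    c * (shift e (δ 0) ⊛ h) n   ≡⟨ cong (c *_) (shift-⊛ (δ 0) h e n) ⟩
    c * shift e (δ 0 ⊛ h) n     ≡⟨ cong (c *_) (shift-cong (δ₀-⊛ h) e n) ⟩
    c * shift e h n           ∎
    where open ≡-Reasoning

  AssociatesWith⊛ : Series → Set
  AssociatesWith⊛ f = ∀ g h n → ((f ⊛ g) ⊛ h) n ≡ (f ⊛ (g ⊛ h)) n

  mono-associates : ∀ c e → AssociatesWith⊛ (mono c e)
  mono-associates c e g h n = begin
    ((mono c e ⊛ g) ⊛ h) n   ≡⟨ ⊛-congˡ h n (mono-⊛ c e g) ⟩
    ((c ∙ shift e g) ⊛ h) n  ≡⟨ ⊛-∙ˡ c (shift e g) h n ⟩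
    c * (shift e g ⊛ h) n    ≡⟨ cong (c *_) (shift-⊛ g h e n) ⟩
    c * shift e (g ⊛ h) n    ≡⟨ mono-⊛ c e (g ⊛ h) n ⟨
    (mono c e ⊛ (g ⊛ h)) n   ∎
    where open ≡-Reasoning

  ⊕-associates : ∀ f₁ f₂ → AssociatesWith⊛ f₁ → AssociatesWith⊛ f₂ → AssociatesWith⊛ (f₁ ⊕ f₂)
  ⊕-associates f₁ f₂ assoc₁ assoc₂ g h n = begin
    (((f₁ ⊕ f₂) ⊛ g) ⊛ h) n                 ≡⟨ ⊛-congˡ h n (⊛-distribʳ-⊕ f₁ f₂ g) ⟩
    (((f₁ ⊛ g) ⊕ (f₂ ⊛ g)) ⊛ h) n           ≡⟨ ⊛-distribʳ-⊕ (f₁ ⊛ g) (f₂ ⊛ g) h n ⟩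
    ((f₁ ⊛ g) ⊛ h) n + ((f₂ ⊛ g) ⊛ h) n     ≡⟨ cong₂ _+_ (assoc₁ g h n) (assoc₂ g h n) ⟩
    (f₁ ⊛ (g ⊛ h)) n + (f₂ ⊛ (g ⊛ h)) n     ≡⟨ ⊛-distribʳ-⊕ f₁ f₂ (g ⊛ h) n ⟨
    ((f₁ ⊕ f₂) ⊛ (g ⊛ h)) n                 ∎
    where open ≡-Reasoning

  den-associates : ∀ k → AssociatesWith⊛ (den k)
  den-associates k =
    ⊕-associates (mono (+ 1) 0 ⊕ mono (- + 2) 1) (mono (+ 1) (suc k))
      (⊕-associates (mono (+ 1) 0) (mono (- + 2) 1) (mono-associates (+ 1) 0) (mono-associates (- + 2) 1))
      (mono-associates (+ 1) (suc k))

  denTimes : ℕ → Series → Series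
  denTimes k h n = h n - + 2 * shift 1 h n + shift (suc k) h n

  den-⊛ : ∀ k h n → (den k ⊛ h) n ≡ denTimes k h n
  den-⊛ k h n = begin
    (den k ⊛ h) n
      ≡⟨ ⊛-distribʳ-⊕ (mono (+ 1) 0 ⊕ mono (- + 2) 1) (mono (+ 1) (suc k)) h n ⟩
    ((mono (+ 1) 0 ⊕ mono (- + 2) 1) ⊛ h) n + (mono (+ 1) (suc k) ⊛ h) n
      ≡⟨ cong (_+ (mono (+ 1) (suc k) ⊛ h) n) (⊛-distribʳ-⊕ (mono (+ 1) 0) (mono (- + 2) 1) h n) ⟩
    (mono (+ 1) 0 ⊛ h) n + (mono (- + 2) 1 ⊛ h) n + (mono (+ 1) (suc k) ⊛ h) n
      ≡⟨ cong₂ _+_ (cong₂ _+_ (mono-⊛ (+ 1) 0 h n) (mono-⊛ (- + 2) 1 h n)) (mono-⊛ (+ 1) (suc k) h n) ⟩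
    + 1 * h n + - + 2 * shift 1 h n + + 1 * shift (suc k) h n
      ≡⟨ normalise (h n) (shift 1 h n) (shift (suc k) h n) ⟩
    denTimes k h n
      ∎
    where
    open ≡-Reasoning
    normalise : ∀ x y z → + 1 * x + - + 2 * y + + 1 * z ≡ x - + 2 * y + z
    normalise = solve-∀

  denTimes-⊕ : ∀ k f g n → denTimes k (f ⊕ g) n ≡ denTimes k f n + denTimes k g n
  denTimes-⊕ k f g n = begin
    denTimes k (f ⊕ g) n
      ≡⟨ cong₂ (λ y z → f n + g n - + 2 * y + z) (shift-⊕ f g 1 n) (shift-⊕ f g (suc k) n) ⟩
    f n + g n - + 2 * (shift 1 f n + shift 1 g n) + (shift (suc k) f n + shift (suc k) g n)
      ≡⟨ regroup (f n) (g n) (shift 1 f n) (shift 1 g n) (shift (suc k) f n) (shift (suc k) g n) ⟩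
    denTimes k f n + denTimes k g n
      ∎
    where
    open ≡-Reasoning
    regroup : ∀ a b c d e f → a + b - + 2 * (c + d) + (e + f) ≡ (a - + 2 * c + e) + (b - + 2 * d + f)
    regroup = solve-∀

  denTimes-∙ : ∀ k c f n → denTimes k (c ∙ f) n ≡ c * denTimes k f n
  denTimes-∙ k c f n = begin
    denTimes k (c ∙ f) n
      ≡⟨ cong₂ (λ y z → c * f n - + 2 * y + z) (shift-∙ c f 1 n) (shift-∙ c f (suc k) n) ⟩
    c * f n - + 2 * (c * shift 1 f n) + c * shift (suc k) f n
      ≡⟨ factor c (f n) (shift 1 f n) (shift (suc k) f n) ⟩
    c * denTimes k f n
      ∎
    where
    open ≡-Reasoning
    factor : ∀ c x y z → c * x - + 2 * (c * y) + c * z ≡ c * (x - + 2 * y + z)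
    factor = solve-∀

  denTimes-shift : ∀ k h j n → denTimes k (shift j h) n ≡ shift j (denTimes k h) n
  denTimes-shift k h j n = begin
    denTimes k (shift j h) n
      ≡⟨ cong₂ (λ y z → shift j h n - + 2 * y + z) (shift-comm h 1 j n) (shift-comm h (suc k) j n) ⟩
    shift j h n - + 2 * shift j (shift 1 h) n + shift j (shift (suc k) h) n
      ≡⟨ cong (λ y → shift j h n - y + shift j (shift (suc k) h) n) (shift-∙ (+ 2) (shift 1 h) j n) ⟨
    shift j h n - shift j (+ 2 ∙ shift 1 h) n + shift j (shift (suc k) h) n
      ≡⟨ cong (_+ shift j (shift (suc k) h) n) (shift-− h (+ 2 ∙ shift 1 h) j n) ⟨
    shift j (λ i → h i - + 2 * shift 1 h i) n + shift j (shift (suc k) h) n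
      ≡⟨ shift-⊕ (λ i → h i - + 2 * shift 1 h i) (shift (suc k) h) j n ⟨
    shift j (denTimes k h) n
      ∎
    where open ≡-Reasoning

  linearCombination : List (ℤ × Series) → Series
  linearCombination []              i = 0ℤ
  linearCombination ((c , f) ∷ cfs) i = c * f i + linearCombination cfs i

  shift-0 : ∀ j n → shift j (λ _ → 0ℤ) n ≡ 0ℤ
  shift-0 zero    n       = refl
  shift-0 (suc j) zero    = refl
  shift-0 (suc j) (suc n) = shift-0 j n

  denTimes-linearCombination : ∀ k cfs n →
    denTimes k (linearCombination cfs) n ≡ linearCombination (map (λ (c , f) → c , denTimes k f) cfs) n
  denTimes-linearCombination k []              n = cong₂ (λ y z → 0ℤ - + 2 * y + z) (shift-0 1 n) (shift-0 (suc k) n)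
  denTimes-linearCombination k ((c , f) ∷ cfs) n =
    trans (denTimes-⊕ k (c ∙ f) (linearCombination cfs) n)
          (cong₂ _+_ (denTimes-∙ k c f n) (denTimes-linearCombination k cfs n))

  denTimes-δ : ∀ k j n → denTimes k (δ j) n ≡ δ j n - + 2 * δ (suc j) n + δ (suc k ℕ.+ j) n
  denTimes-δ k j n = cong₂ (λ y z → δ j n - + 2 * y + z) (shift-mono (+ 1) j 1 n) (shift-mono (+ 1) j (suc k) n)

module WordSums where

  open import Data.Bool using (Bool; true; false; if_then_else_)
  open import Data.Nat using (ℕ; zero; suc; _+_; _≤ᵇ_)
  open import Data.Nat.Properties using (+-identityʳ; +-assoc; +-comm)
  open import Data.Nat.ListAction using (sum)
  open import Data.Nat.ListAction.Properties using (sum-++)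
  import Data.Integer as ℤ
  open import Data.List using (List; []; _∷_; _++_; map; length; replicate; filterᵇ)
  open import Data.List.Properties using (map-++; map-∘)
  open import Relation.Binary.PropositionalEquality
  open PowerSeries using (shift)

  sum-filterᵇ : ∀ {A : Set} (p : A → Bool) (f : A → ℕ) xs →
                sum (map f (filterᵇ p xs)) ≡ sum (map (λ x → if p x then f x else 0) xs)
  sum-filterᵇ p f []       = refl
  sum-filterᵇ p f (x ∷ xs) with p x
  ... | true  = cong (f x +_) (sum-filterᵇ p f xs)
  ... | false = sum-filterᵇ p f xs

  wordSum : ℕ → (List Bool → ℕ) → ℕ
  wordSum n f = sum (map f (wordsOfLength n))

  wordSum-suc : ∀ n f → wordSum (suc n) f ≡ wordSum n (λ w → f (false ∷ w)) + wordSum n (λ w → f (true ∷ w))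
  wordSum-suc n f = begin
    sum (map f (map (false ∷_) W ++ map (true ∷_) W))
      ≡⟨ cong sum (map-++ f (map (false ∷_) W) (map (true ∷_) W)) ⟩
    sum (map f (map (false ∷_) W) ++ map f (map (true ∷_) W))
      ≡⟨ sum-++ (map f (map (false ∷_) W)) _ ⟩
    sum (map f (map (false ∷_) W)) + sum (map f (map (true ∷_) W))
      ≡⟨ cong₂ _+_ (cong sum (map-∘ W)) (cong sum (map-∘ W)) ⟨
    wordSum n (λ w → f (false ∷ w)) + wordSum n (λ w → f (true ∷ w))
      ∎
    where
    open ≡-Reasoning
    W = wordsOfLength n

  wordSum-cong : ∀ n {f g} → (∀ w → length w ≡ n → f w ≡ g w) → wordSum n f ≡ wordSum n g
  wordSum-cong zero    f≗g = cong (_+ 0) (f≗g [] refl)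
  wordSum-cong (suc n) {f} {g} f≗g = begin
    wordSum (suc n) f
      ≡⟨ wordSum-suc n f ⟩
    wordSum n (λ w → f (false ∷ w)) + wordSum n (λ w → f (true ∷ w))
      ≡⟨ cong₂ _+_ (wordSum-cong n (λ w ∣w∣≡n → f≗g (false ∷ w) (cong suc ∣w∣≡n)))
                   (wordSum-cong n (λ w ∣w∣≡n → f≗g (true ∷ w) (cong suc ∣w∣≡n))) ⟩
    wordSum n (λ w → g (false ∷ w)) + wordSum n (λ w → g (true ∷ w))
      ≡⟨ wordSum-suc n g ⟨
    wordSum (suc n) g
      ∎
    where open ≡-Reasoning

  wordSum-+ : ∀ n f g → wordSum n (λ w → f w + g w) ≡ wordSum n f + wordSum n g
  wordSum-+ zero    f g = trans (+-identityʳ (f [] + g [])) (sym (cong₂ _+_ (+-identityʳ (f [])) (+-identityʳ (g []))))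
  wordSum-+ (suc n) f g = begin
    wordSum (suc n) (λ w → f w + g w)
      ≡⟨ wordSum-suc n (λ w → f w + g w) ⟩
    wordSum n (λ w → f (false ∷ w) + g (false ∷ w)) + wordSum n (λ w → f (true ∷ w) + g (true ∷ w))
      ≡⟨ cong₂ _+_ (wordSum-+ n (λ w → f (false ∷ w)) (λ w → g (false ∷ w)))
                   (wordSum-+ n (λ w → f (true ∷ w)) (λ w → g (true ∷ w))) ⟩
    (f₀ + g₀) + (f₁ + g₁)
      ≡⟨ interchange f₀ g₀ f₁ g₁ ⟩
    (f₀ + f₁) + (g₀ + g₁)
      ≡⟨ cong₂ _+_ (wordSum-suc n f) (wordSum-suc n g) ⟨
    wordSum (suc n) f + wordSum (suc n) g
      ∎
    where
    open ≡-Reasoning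
    f₀ f₁ g₀ g₁ : ℕ
    f₀ = wordSum n (λ w → f (false ∷ w))
    f₁ = wordSum n (λ w → f (true ∷ w))
    g₀ = wordSum n (λ w → g (false ∷ w))
    g₁ = wordSum n (λ w → g (true ∷ w))
    interchange : ∀ a b c d → (a + b) + (c + d) ≡ (a + c) + (b + d)
    interchange a b c d = begin
      (a + b) + (c + d) ≡⟨ +-assoc a b (c + d) ⟩
      a + (b + (c + d)) ≡⟨ cong (a +_) (trans (sym (+-assoc b c d)) (trans (cong (_+ d) (+-comm b c)) (+-assoc c b d))) ⟩
      a + (c + (b + d)) ≡⟨ +-assoc a c (b + d) ⟨
      (a + c) + (b + d) ∎

  wordSum-zero : ∀ n → wordSum n (λ _ → 0) ≡ 0
  wordSum-zero zero    = refl
  wordSum-zero (suc n) = trans (wordSum-suc n (λ _ → 0)) (cong₂ _+_ (wordSum-zero n) (wordSum-zero n))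

  ≤ᵇ-suc : ∀ a b → (suc a ≤ᵇ suc b) ≡ (a ≤ᵇ b)
  ≤ᵇ-suc zero    b = refl
  ≤ᵇ-suc (suc a) b = refl

  wordSum-leadingOnes : ∀ j n f →
    ℤ.+ wordSum n (λ w → if j ≤ᵇ leadingOnes w then f w else 0)
      ≡ shift j (λ m → ℤ.+ wordSum m (λ u → f (replicate j true ++ u))) n
  wordSum-leadingOnes zero    n       f = refl
  wordSum-leadingOnes (suc j) zero    f = refl
  wordSum-leadingOnes (suc j) (suc n) f = begin
    ℤ.+ wordSum (suc n) (λ w → if suc j ≤ᵇ leadingOnes w then f w else 0)
      ≡⟨ cong ℤ.+_ (wordSum-suc n _) ⟩
    ℤ.+ (wordSum n (λ _ → 0) + onesFirst)
      ≡⟨ cong (λ z → ℤ.+ (z + onesFirst)) (wordSum-zero n) ⟩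
    ℤ.+ onesFirst
      ≡⟨ cong ℤ.+_ (wordSum-cong n (λ w _ → cong (λ b → if b then f (true ∷ w) else 0) (≤ᵇ-suc j (leadingOnes w)))) ⟩
    ℤ.+ wordSum n (λ w → if j ≤ᵇ leadingOnes w then f (true ∷ w) else 0)
      ≡⟨ wordSum-leadingOnes j n (λ w → f (true ∷ w)) ⟩
    shift (suc j) (λ m → ℤ.+ wordSum m (λ u → f (replicate (suc j) true ++ u))) (suc n)
      ∎
    where
    open ≡-Reasoning
    onesFirst : ℕ
    onesFirst = wordSum n (λ w → if suc j ≤ᵇ suc (leadingOnes w) then f (true ∷ w) else 0)

module Runs where

  open import Data.Bool using (true; false; _∨_; _xor_)
  open import Data.Nat using (zero; suc; _+_; _≤_; _<_; _≤ᵇ_; s≤s)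
  open import Data.Nat.Properties using (+-identityʳ; <⇒≤)
  open import Data.List using (_∷_; _++_; replicate)
  open import Relation.Binary.PropositionalEquality
  open DegreeTwo using (changes)

  ≤ᵇ-true : ∀ {m n} → m ≤ n → (m ≤ᵇ n) ≡ true
  ≤ᵇ-true {zero}        _         = refl
  ≤ᵇ-true {suc zero}    (s≤s _)   = refl
  ≤ᵇ-true {suc (suc m)} (s≤s m<n) = ≤ᵇ-true m<n

  ≤ᵇ-false : ∀ {m n} → n < m → (m ≤ᵇ n) ≡ false
  ≤ᵇ-false {suc m}       {zero}  _         = refl
  ≤ᵇ-false {suc (suc m)} {suc n} (s≤s n<m) = ≤ᵇ-false n<m

  leadingOnes-replicate : ∀ j u → leadingOnes (replicate j true ++ u) ≡ j + leadingOnes u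
  leadingOnes-replicate zero    u = refl
  leadingOnes-replicate (suc j) u = cong suc (leadingOnes-replicate j u)

  hasRun-replicate : ∀ k j u → leadingOnes u ≡ 0 → j < k → hasRun k (replicate j true ++ u) ≡ hasRun k u
  hasRun-replicate k zero    u _     _   = refl
  hasRun-replicate k (suc j) u lead₀ j<k = cong₂ _∨_ (≤ᵇ-false suc[lead]<k) (hasRun-replicate k j u lead₀ (<⇒≤ j<k))
    where
    suc[lead]<k : suc (leadingOnes (replicate j true ++ u)) < k
    suc[lead]<k = subst (λ l → suc l < k) (sym (trans (leadingOnes-replicate j u) (trans (cong (j +_) lead₀) (+-identityʳ j)))) j<k

  changes-replicate : ∀ j b → changes (replicate j b) ≡ 0
  changes-replicate zero          b = refl
  changes-replicate (suc zero)    b = refl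
  changes-replicate (suc (suc j)) false = changes-replicate (suc j) false
  changes-replicate (suc (suc j)) true  = changes-replicate (suc j) true

  changes-replicate-++ : ∀ j b c u → changes (replicate (suc j) b ++ c ∷ u) ≡ bit (b xor c) + changes (c ∷ u)
  changes-replicate-++ zero    b     c u = refl
  changes-replicate-++ (suc j) false c u = changes-replicate-++ j false c u
  changes-replicate-++ (suc j) true  c u = changes-replicate-++ j true c u

module Counting (k′ : ℕ) where

  open import Data.Bool using (Bool; true; false; not; _∨_; if_then_else_)
  open import Data.Nat using (ℕ; suc; _+_; _*_; _≤_; _≤ᵇ_; _<ᵇ_; s≤s)
  open import Data.Nat.Properties using (+-identityʳ; +-assoc; +-comm; *-identityʳ; *-zeroʳ; *-distribˡ-+; n<1+n; m≤m+n; +-suc)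
  open import Data.Nat.ListAction using (sum)
  open import Data.Nat.Tactic.RingSolver using (solve-∀)
  open import Data.List using (List; []; _∷_; _++_; length; replicate)
  open import Data.List.Properties using (++-identityʳ)
  open import Relation.Binary.PropositionalEquality
  open DegreeTwo using (changes)
  open WordSums
  open Runs

  maxRun k : ℕ
  maxRun = suc k′
  k      = suc maxRun

  good : List Bool → Bool
  good w = not (hasRun k w)

  goodBit : List Bool → ℕ
  goodBit w = bit (good w)

  weight : List Bool → ℕ
  weight w = if good w then 4 + changes w else 0

  startsWithOne startsWithZero : List Bool → ℕ
  startsWithOne  []      = 0
  startsWithOne  (b ∷ _) = bit b
  startsWithZero []      = 0
  startsWithZero (b ∷ _) = bit (not b)

  longPrefix : (List Bool → ℕ) → List Bool → ℕ
  longPrefix f w = if maxRun ≤ᵇ leadingOnes w then f w else 0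

  afterLongPrefix : (List Bool → ℕ) → ℕ → ℕ
  afterLongPrefix f m = wordSum m (λ u → f (replicate maxRun true ++ u))

  goodCount weightTotal goodNonempty goodStartingWithOne : ℕ → ℕ
  goodCount           n = wordSum n goodBit
  weightTotal         n = wordSum n weight
  goodNonempty        n = wordSum n (λ w → goodBit w * (startsWithOne w + startsWithZero w))
  goodStartingWithOne n = wordSum n (λ w → goodBit w * startsWithOne w)

  -- Prepending 1 to a good word w keeps it good unless w already starts with k − 1 ones.
  goodBit-true : ∀ w → goodBit (true ∷ w) + longPrefix goodBit w ≡ goodBit w
  goodBit-true w with k′ <ᵇ leadingOnes w | hasRun k w
  ... | true  | true  = refl
  ... | true  | false = refl
  ... | false | true  = refl
  ... | false | false = refl

  goodCount-suc : ∀ n → goodCount (suc n) + wordSum n (longPrefix goodBit) ≡ goodCount n + goodCount n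
  goodCount-suc n = begin
    goodCount (suc n) + wordSum n (longPrefix goodBit)
      ≡⟨ cong (_+ wordSum n (longPrefix goodBit)) (wordSum-suc n goodBit) ⟩
    goodCount n + wordSum n (λ w → goodBit (true ∷ w)) + wordSum n (longPrefix goodBit)
      ≡⟨ +-assoc (goodCount n) _ _ ⟩
    goodCount n + (wordSum n (λ w → goodBit (true ∷ w)) + wordSum n (longPrefix goodBit))
      ≡⟨ cong (goodCount n +_) (wordSum-+ n (λ w → goodBit (true ∷ w)) (longPrefix goodBit)) ⟨
    goodCount n + wordSum n (λ w → goodBit (true ∷ w) + longPrefix goodBit w)
      ≡⟨ cong (goodCount n +_) (wordSum-cong n (λ w _ → goodBit-true w)) ⟩
    goodCount n + goodCount n
      ∎
    where open ≡-Reasoning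

  changes-false : ∀ w → changes (false ∷ w) ≡ changes w + startsWithOne w
  changes-false []      = refl
  changes-false (c ∷ w) = +-comm (bit c) (changes (c ∷ w))

  weight-false : ∀ w → weight (false ∷ w) ≡ weight w + goodBit w * startsWithOne w
  weight-false w with hasRun k w
  ... | true  = refl
  ... | false = begin
    4 + changes (false ∷ w)                 ≡⟨ cong (4 +_) (changes-false w) ⟩
    4 + (changes w + startsWithOne w)       ≡⟨ +-assoc 4 (changes w) (startsWithOne w) ⟨
    4 + changes w + startsWithOne w         ≡⟨ cong (4 + changes w +_) (+-identityʳ (startsWithOne w)) ⟨
    4 + changes w + 1 * startsWithOne w     ∎
    where open ≡-Reasoning

  x+y*0≡x : ∀ x y → x + y * 0 ≡ x
  x+y*0≡x = solve-∀

  weight-true : ∀ w → weight (true ∷ w) + longPrefix weight w ≡ weight w + goodBit w * startsWithZero w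
  weight-true [] = refl
  weight-true (false ∷ w) with hasRun k w
  ... | true  = refl
  ... | false = arith (changes (false ∷ w))
    where
    arith : ∀ x → 4 + (1 + x) + 0 ≡ 4 + x + 1 * 1
    arith = solve-∀
  weight-true (true ∷ w) with k′ <ᵇ suc (leadingOnes w)
  ... | true  = sym (x+y*0≡x (weight (true ∷ w)) (goodBit (true ∷ w)))
  ... | false = trans (+-identityʳ _) (sym (x+y*0≡x (weight (true ∷ w)) (goodBit (true ∷ w))))

  weightTotal-suc : ∀ n → weightTotal (suc n) + wordSum n (longPrefix weight)
                            ≡ weightTotal n + weightTotal n + goodNonempty n
  weightTotal-suc n = begin
    weightTotal (suc n) + wordSum n (longPrefix weight)
      ≡⟨ cong (_+ wordSum n (longPrefix weight)) (wordSum-suc n weight) ⟩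
    wordSum n (λ w → weight (false ∷ w)) + wordSum n (λ w → weight (true ∷ w)) + wordSum n (longPrefix weight)
      ≡⟨ +-assoc (wordSum n (λ w → weight (false ∷ w))) _ _ ⟩
    wordSum n (λ w → weight (false ∷ w)) + (wordSum n (λ w → weight (true ∷ w)) + wordSum n (longPrefix weight))
      ≡⟨ cong₂ _+_ (wordSum-cong n (λ w _ → weight-false w))
                   (sym (wordSum-+ n (λ w → weight (true ∷ w)) (longPrefix weight))) ⟩
    wordSum n (λ w → weight w + goodBit w * startsWithOne w) + wordSum n (λ w → weight (true ∷ w) + longPrefix weight w)
      ≡⟨ cong₂ _+_ (wordSum-+ n weight (λ w → goodBit w * startsWithOne w))
                   (trans (wordSum-cong n (λ w _ → weight-true w)) (wordSum-+ n weight (λ w → goodBit w * startsWithZero w))) ⟩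
    (weightTotal n + goodStartingWithOne n) + (weightTotal n + goodStartingWithZero)
      ≡⟨ interchange (weightTotal n) (goodStartingWithOne n) (weightTotal n) goodStartingWithZero ⟩
    weightTotal n + weightTotal n + (goodStartingWithOne n + goodStartingWithZero)
      ≡⟨ cong (weightTotal n + weightTotal n +_) (wordSum-+ n (λ w → goodBit w * startsWithOne w) (λ w → goodBit w * startsWithZero w)) ⟨
    weightTotal n + weightTotal n + wordSum n (λ w → goodBit w * startsWithOne w + goodBit w * startsWithZero w)
      ≡⟨ cong (weightTotal n + weightTotal n +_) (wordSum-cong n (λ w _ → *-distribˡ-+ (goodBit w) (startsWithOne w) (startsWithZero w))) ⟨
    weightTotal n + weightTotal n + goodNonempty n
      ∎
    where
    open ≡-Reasoning
    goodStartingWithZero : ℕ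
    goodStartingWithZero = wordSum n (λ w → goodBit w * startsWithZero w)
    interchange : ∀ a b c d → (a + b) + (c + d) ≡ (a + c) + (b + d)
    interchange = solve-∀

  goodNonempty-suc : ∀ n → goodNonempty (suc n) ≡ goodCount (suc n)
  goodNonempty-suc n = wordSum-cong (suc n) nonempty
    where
    nonempty : ∀ w → length w ≡ suc n → goodBit w * (startsWithOne w + startsWithZero w) ≡ goodBit w
    nonempty (false ∷ w) _ = *-identityʳ (goodBit (false ∷ w))
    nonempty (true  ∷ w) _ = *-identityʳ (goodBit (true ∷ w))

  goodStartingWithOne-suc : ∀ n → goodStartingWithOne (suc n) + goodCount n ≡ goodCount (suc n)
  goodStartingWithOne-suc n = begin
    goodStartingWithOne (suc n) + goodCount n
      ≡⟨ cong (_+ goodCount n) (wordSum-suc n (λ w → goodBit w * startsWithOne w)) ⟩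
    wordSum n (λ w → goodBit (false ∷ w) * 0) + wordSum n (λ w → goodBit (true ∷ w) * 1) + goodCount n
      ≡⟨ cong (_+ goodCount n) (cong₂ _+_ (trans (wordSum-cong n (λ w _ → *-zeroʳ (goodBit w))) (wordSum-zero n))
                                          (wordSum-cong n (λ w _ → *-identityʳ (goodBit (true ∷ w))))) ⟩
    wordSum n (λ w → goodBit (true ∷ w)) + goodCount n
      ≡⟨ +-comm _ (goodCount n) ⟩
    goodCount n + wordSum n (λ w → goodBit (true ∷ w))
      ≡⟨ wordSum-suc n goodBit ⟨
    goodCount (suc n)
      ∎
    where open ≡-Reasoning

  hasRun-afterLongPrefix-true : ∀ u → hasRun k (replicate maxRun true ++ true ∷ u) ≡ true
  hasRun-afterLongPrefix-true u = cong (_∨ hasRun k (replicate k′ true ++ true ∷ u)) (≤ᵇ-true k≤lead)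
    where
    k≤lead : k ≤ suc (leadingOnes (replicate k′ true ++ true ∷ u))
    k≤lead = s≤s (subst (maxRun ≤_) (sym (trans (leadingOnes-replicate k′ (true ∷ u)) (+-suc k′ _))) (s≤s (m≤m+n k′ _)))

  afterLongPrefix-goodBit-zero : afterLongPrefix goodBit 0 ≡ 1
  afterLongPrefix-goodBit-zero rewrite hasRun-replicate k maxRun [] refl (n<1+n maxRun) = refl

  afterLongPrefix-goodBit-suc : ∀ m → afterLongPrefix goodBit (suc m) ≡ goodCount m
  afterLongPrefix-goodBit-suc m = begin
    afterLongPrefix goodBit (suc m)
      ≡⟨ wordSum-suc m _ ⟩
    wordSum m (λ u → goodBit (replicate maxRun true ++ false ∷ u)) + wordSum m (λ u → goodBit (replicate maxRun true ++ true ∷ u))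
      ≡⟨ cong₂ _+_ (wordSum-cong m (λ u _ → cong (λ b → bit (not b)) (hasRun-replicate k maxRun (false ∷ u) refl (n<1+n maxRun))))
                   (trans (wordSum-cong m (λ u _ → cong (λ b → bit (not b)) (hasRun-afterLongPrefix-true u))) (wordSum-zero m)) ⟩
    goodCount m + 0
      ≡⟨ +-identityʳ _ ⟩
    goodCount m
      ∎
    where open ≡-Reasoning

  afterLongPrefix-weight-zero : afterLongPrefix weight 0 ≡ 4
  afterLongPrefix-weight-zero
    rewrite hasRun-replicate k maxRun [] refl (n<1+n maxRun) | ++-identityʳ (replicate maxRun true)
          | changes-replicate maxRun true = refl

  weight-afterLongPrefix-false : ∀ u → weight (replicate maxRun true ++ false ∷ u)
                                        ≡ weight u + goodBit u * startsWithOne u + goodBit u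
  weight-afterLongPrefix-false u
    rewrite hasRun-replicate k maxRun (false ∷ u) refl (n<1+n maxRun) | changes-replicate-++ k′ true false u
    with hasRun k u
  ... | true  = refl
  ... | false = trans (cong (λ x → 4 + (1 + x)) (changes-false u)) (arith (changes u) (startsWithOne u))
    where
    arith : ∀ x y → 4 + (1 + (x + y)) ≡ 4 + x + 1 * y + 1
    arith = solve-∀

  afterLongPrefix-weight-suc : ∀ m → afterLongPrefix weight (suc m) ≡ weightTotal m + goodStartingWithOne m + goodCount m
  afterLongPrefix-weight-suc m = begin
    afterLongPrefix weight (suc m)
      ≡⟨ wordSum-suc m _ ⟩
    wordSum m (λ u → weight (replicate maxRun true ++ false ∷ u)) + wordSum m (λ u → weight (replicate maxRun true ++ true ∷ u))
      ≡⟨ cong₂ _+_ (wordSum-cong m (λ u _ → weight-afterLongPrefix-false u))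
                   (trans (wordSum-cong m (λ u _ → cong (λ b → if not b then 4 + changes (replicate maxRun true ++ true ∷ u) else 0) (hasRun-afterLongPrefix-true u))) (wordSum-zero m)) ⟩
    wordSum m (λ u → weight u + goodBit u * startsWithOne u + goodBit u) + 0
      ≡⟨ +-identityʳ _ ⟩
    wordSum m (λ u → weight u + goodBit u * startsWithOne u + goodBit u)
      ≡⟨ wordSum-+ m (λ u → weight u + goodBit u * startsWithOne u) goodBit ⟩
    wordSum m (λ u → weight u + goodBit u * startsWithOne u) + goodCount m
      ≡⟨ cong (_+ goodCount m) (wordSum-+ m weight (λ u → goodBit u * startsWithOne u)) ⟩
    weightTotal m + goodStartingWithOne m + goodCount m
      ∎
    where open ≡-Reasoning

  goodWords-weight : ∀ m → sum (Data.List.map (degCount 2) (F (suc m) k)) ≡ weightTotal (suc m)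
  goodWords-weight m = trans (sum-filterᵇ good (degCount 2) (wordsOfLength (suc m))) (wordSum-cong (suc m) degCount-if-good)
    where
    degCount-if-good : ∀ w → length w ≡ suc m → (if good w then degCount 2 w else 0) ≡ weight w
    degCount-if-good (b ∷ w) _ with hasRun k (b ∷ w)
    ... | true  = refl
    ... | false = DegreeTwo.degCount2-cons b w

module GeneratingFunctions (k′ : ℕ) where

  open import Data.Nat as ℕ using (ℕ; zero; suc)
  open import Data.Nat.Properties using (+-comm; +-suc)
  open import Data.Integer using (ℤ; +_; 0ℤ; _+_; _*_; -_; _-_)
  open import Data.Integer.Properties using (pos-+; +-identityʳ)
  open import Data.Integer.Tactic.RingSolver using (solve)
  open import Data.List using (List; []; _∷_)
  open import Data.Product using (_×_; _,_)
  open import Relation.Binary.PropositionalEquality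
  open PowerSeries
  open WordSums using (wordSum; wordSum-leadingOnes)
  open Counting k′

  A E B S : Series
  A i = + goodCount i
  E i = + weightTotal i
  B i = + goodStartingWithOne i
  S   = seriesCoeff k

  x+y≡z⇒x≡z-y : ∀ x y {z} → x + y ≡ z → x ≡ z - y
  x+y≡z⇒x≡z-y x y refl = solve (x ∷ y ∷ [])

  longPrefix-shift : ∀ f m → + wordSum m (longPrefix f) ≡ shift maxRun (λ i → + afterLongPrefix f i) m
  longPrefix-shift f m = wordSum-leadingOnes maxRun m f

  longPrefix-goodBit : ∀ m → + wordSum m (longPrefix goodBit) ≡ δ maxRun m + shift k A m
  longPrefix-goodBit m = begin
    + wordSum m (longPrefix goodBit)                    ≡⟨ longPrefix-shift goodBit m ⟩
    shift maxRun (λ i → + afterLongPrefix goodBit i) m   ≡⟨ shift-cong afterLongPrefix-goodBit maxRun m ⟩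
    shift maxRun (δ 0 ⊕ shift 1 A) m                    ≡⟨ shift-⊕ (δ 0) (shift 1 A) maxRun m ⟩
    shift maxRun (δ 0) m + shift maxRun (shift 1 A) m   ≡⟨ cong₂ _+_ (shift-δ₀ maxRun m) (shift-shift-suc A maxRun m) ⟩
    δ maxRun m + shift k A m                            ∎
    where
    open ≡-Reasoning
    afterLongPrefix-goodBit : ∀ i → + afterLongPrefix goodBit i ≡ (δ 0 ⊕ shift 1 A) i
    afterLongPrefix-goodBit zero    = cong +_ afterLongPrefix-goodBit-zero
    afterLongPrefix-goodBit (suc i) = cong +_ (afterLongPrefix-goodBit-suc i)

  longPrefix-weight : ∀ m → + wordSum m (longPrefix weight) ≡ + 4 * δ maxRun m + (shift k E m + shift k B m + shift k A m)
  longPrefix-weight m = begin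
    + wordSum m (longPrefix weight)
      ≡⟨ longPrefix-shift weight m ⟩
    shift maxRun (λ i → + afterLongPrefix weight i) m
      ≡⟨ shift-cong afterLongPrefix-weight maxRun m ⟩
    shift maxRun (+ 4 ∙ δ 0 ⊕ shift 1 (E ⊕ B ⊕ A)) m
      ≡⟨ shift-⊕ (+ 4 ∙ δ 0) (shift 1 (E ⊕ B ⊕ A)) maxRun m ⟩
    shift maxRun (+ 4 ∙ δ 0) m + shift maxRun (shift 1 (E ⊕ B ⊕ A)) m
      ≡⟨ cong₂ _+_ (trans (shift-∙ (+ 4) (δ 0) maxRun m) (cong (+ 4 *_) (shift-δ₀ maxRun m)))
                   (shift-shift-suc (E ⊕ B ⊕ A) maxRun m) ⟩
    + 4 * δ maxRun m + shift k (E ⊕ B ⊕ A) m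
      ≡⟨ cong (_+_ (+ 4 * δ maxRun m)) (trans (shift-⊕ (E ⊕ B) A k m) (cong (_+ shift k A m) (shift-⊕ E B k m))) ⟩
    + 4 * δ maxRun m + (shift k E m + shift k B m + shift k A m)
      ∎
    where
    open ≡-Reasoning
    afterLongPrefix-weight : ∀ i → + afterLongPrefix weight i ≡ (+ 4 ∙ δ 0 ⊕ shift 1 (E ⊕ B ⊕ A)) i
    afterLongPrefix-weight zero    = cong +_ afterLongPrefix-weight-zero
    afterLongPrefix-weight (suc i) = cong +_ (afterLongPrefix-weight-suc i)

  denTimes-A : ∀ n → denTimes k A n ≡ δ 0 n - δ k n
  denTimes-A zero    = refl
  denTimes-A (suc m) = eliminate (A (suc m)) (A m) (δ maxRun m) (shift k A m) recurrence
    where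
    recurrence : A (suc m) + (δ maxRun m + shift k A m) ≡ A m + A m
    recurrence = begin
      A (suc m) + (δ maxRun m + shift k A m)              ≡⟨ cong (_+_ (A (suc m))) (longPrefix-goodBit m) ⟨
      A (suc m) + + wordSum m (longPrefix goodBit)        ≡⟨ pos-+ (goodCount (suc m)) _ ⟨
      + (goodCount (suc m) ℕ.+ wordSum m (longPrefix goodBit)) ≡⟨ cong +_ (goodCount-suc m) ⟩
      + (goodCount m ℕ.+ goodCount m)                     ≡⟨ pos-+ (goodCount m) (goodCount m) ⟩
      A m + A m                                           ∎
      where open ≡-Reasoning
    eliminate : ∀ x y u v → x + (u + v) ≡ y + y → x - + 2 * y + v ≡ 0ℤ - u
    eliminate x y u v eq = begin
      x - + 2 * y + v             ≡⟨ solve (x ∷ y ∷ u ∷ v ∷ []) ⟩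
      x + (u + v) - (y + y) - u   ≡⟨ cong (λ t → t - (y + y) - u) eq ⟩
      y + y - (y + y) - u         ≡⟨ solve (y ∷ u ∷ []) ⟩
      0ℤ - u                      ∎
      where open ≡-Reasoning

  -- The empty word has weight 4 but the series has no constant term.
  S≡E-4δ₀ : ∀ i → S i ≡ E i - + 4 * δ 0 i
  S≡E-4δ₀ zero    = refl
  S≡E-4δ₀ (suc m) = trans (cong +_ (goodWords-weight m)) (sym (+-identityʳ (E (suc m))))

  goodNonempty≡A-δ₀ : ∀ i → + goodNonempty i ≡ A i - δ 0 i
  goodNonempty≡A-δ₀ zero    = refl
  goodNonempty≡A-δ₀ (suc m) = trans (cong +_ (goodNonempty-suc m)) (sym (+-identityʳ (A (suc m))))

  B≡A-xA-δ₀ : ∀ i → B i ≡ A i - shift 1 A i - δ 0 i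
  B≡A-xA-δ₀ zero    = refl
  B≡A-xA-δ₀ (suc m) = begin
    B (suc m)               ≡⟨ x+y≡z⇒x≡z-y (B (suc m)) (A m) recurrence ⟩
    A (suc m) - A m         ≡⟨ +-identityʳ (A (suc m) - A m) ⟨
    A (suc m) - A m - 0ℤ    ∎
    where
    open ≡-Reasoning
    recurrence : B (suc m) + A m ≡ A (suc m)
    recurrence = trans (sym (pos-+ (goodStartingWithOne (suc m)) (goodCount m))) (cong +_ (goodStartingWithOne-suc m))

  weightTotal-suc-ℤ : ∀ m → E (suc m) + + wordSum m (longPrefix weight) ≡ E m + E m + + goodNonempty m
  weightTotal-suc-ℤ m = begin
    E (suc m) + + wordSum m (longPrefix weight)            ≡⟨ pos-+ (weightTotal (suc m)) _ ⟨
    + (weightTotal (suc m) ℕ.+ wordSum m (longPrefix weight)) ≡⟨ cong +_ (weightTotal-suc m) ⟩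
    + (weightTotal m ℕ.+ weightTotal m ℕ.+ goodNonempty m)  ≡⟨ pos-+ (weightTotal m ℕ.+ weightTotal m) (goodNonempty m) ⟩
    + (weightTotal m ℕ.+ weightTotal m) + + goodNonempty m  ≡⟨ cong (_+ + goodNonempty m) (pos-+ (weightTotal m) (weightTotal m)) ⟩
    E m + E m + + goodNonempty m                            ∎
    where open ≡-Reasoning

  shift-S : ∀ j m → shift j S m ≡ shift j E m - + 4 * δ j m
  shift-S j m = begin
    shift j S m                          ≡⟨ shift-cong S≡E-4δ₀ j m ⟩
    shift j (λ i → E i - + 4 * δ 0 i) m  ≡⟨ shift-− E (+ 4 ∙ δ 0) j m ⟩
    shift j E m - shift j (+ 4 ∙ δ 0) m  ≡⟨ cong (_-_ (shift j E m)) (trans (shift-∙ (+ 4) (δ 0) j m) (cong (+ 4 *_) (shift-δ₀ j m))) ⟩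
    shift j E m - + 4 * δ j m            ∎
    where open ≡-Reasoning

  shift-B : ∀ j m → shift j B m ≡ shift j A m - shift (suc j) A m - δ j m
  shift-B j m = begin
    shift j B m
      ≡⟨ shift-cong B≡A-xA-δ₀ j m ⟩
    shift j (λ i → A i - shift 1 A i - δ 0 i) m
      ≡⟨ shift-− (λ i → A i - shift 1 A i) (δ 0) j m ⟩
    shift j (λ i → A i - shift 1 A i) m - shift j (δ 0) m
      ≡⟨ cong₂ _-_ (trans (shift-− A (shift 1 A) j m) (cong (_-_ (shift j A m)) (shift-shift-suc A j m))) (shift-δ₀ j m) ⟩
    shift j A m - shift (suc j) A m - δ j m
      ∎
    where open ≡-Reasoning

  W-terms : List (ℤ × Series)
  W-terms = (+ 1 , shift 1 A) ∷ (+ 7 , δ 1) ∷ (- + 4 , δ k) ∷ (- + 3 , δ (suc k))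
          ∷ (- + 2 , shift (suc k) A) ∷ (+ 1 , shift (2 ℕ.+ k) A) ∷ []

  W : Series
  W = linearCombination W-terms

  denTimes-S : ∀ n → denTimes k S n ≡ W n
  denTimes-S zero    = refl
  denTimes-S (suc m) =
    eliminate (E (suc m)) (E m) (shift k E m) (A m) (shift k A m) (shift (suc k) A m) (δ 0 m) (δ maxRun m) (δ k m)
              (S≡E-4δ₀ (suc m)) (S≡E-4δ₀ m) (shift-S k m) (weightTotal-suc-ℤ m)
              (goodNonempty≡A-δ₀ m) (longPrefix-weight m) (shift-B k m)
    where
    eliminate : ∀ e₁ e₀ eₖ a aₖ aₖ₊₁ d₀ dᵣ dₖ {s₁ s₀ sₖ p n bₖ} →
                s₁ ≡ e₁ - + 4 * 0ℤ → s₀ ≡ e₀ - + 4 * d₀ → sₖ ≡ eₖ - + 4 * dₖ →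
                e₁ + p ≡ e₀ + e₀ + n → n ≡ a - d₀ →
                p ≡ + 4 * dᵣ + (eₖ + bₖ + aₖ) → bₖ ≡ aₖ - aₖ₊₁ - dₖ →
                s₁ - + 2 * s₀ + sₖ ≡ + 1 * a + (+ 7 * d₀ + (- + 4 * dᵣ + (- + 3 * dₖ + (- + 2 * aₖ + (+ 1 * aₖ₊₁ + 0ℤ)))))
    eliminate e₁ e₀ eₖ a aₖ aₖ₊₁ d₀ dᵣ dₖ refl refl refl recurrence refl refl refl = begin
      e₁ - + 4 * 0ℤ - + 2 * (e₀ - + 4 * d₀) + (eₖ - + 4 * dₖ)
        ≡⟨ cong (λ t → t - + 4 * 0ℤ - + 2 * (e₀ - + 4 * d₀) + (eₖ - + 4 * dₖ)) (x+y≡z⇒x≡z-y e₁ _ recurrence) ⟩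
      e₀ + e₀ + (a - d₀) - (+ 4 * dᵣ + (eₖ + (aₖ - aₖ₊₁ - dₖ) + aₖ)) - + 4 * 0ℤ - + 2 * (e₀ - + 4 * d₀) + (eₖ - + 4 * dₖ)
        ≡⟨ solve (e₀ ∷ eₖ ∷ a ∷ aₖ ∷ aₖ₊₁ ∷ d₀ ∷ dᵣ ∷ dₖ ∷ []) ⟩
      + 1 * a + (+ 7 * d₀ + (- + 4 * dᵣ + (- + 3 * dₖ + (- + 2 * aₖ + (+ 1 * aₖ₊₁ + 0ℤ)))))
        ∎
      where open ≡-Reasoning

  denTimes-shift-A : ∀ j n → denTimes k (shift j A) n ≡ δ j n - δ (j ℕ.+ k) n
  denTimes-shift-A j n = begin
    denTimes k (shift j A) n               ≡⟨ denTimes-shift k A j n ⟩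
    shift j (denTimes k A) n               ≡⟨ shift-cong denTimes-A j n ⟩
    shift j (λ i → δ 0 i - δ k i) n        ≡⟨ shift-− (δ 0) (δ k) j n ⟩
    shift j (δ 0) n - shift j (δ k) n      ≡⟨ cong₂ _-_ (shift-δ₀ j n) (shift-mono (+ 1) k j n) ⟩
    δ j n - δ (j ℕ.+ k) n                  ∎
    where open ≡-Reasoning

  denTimes-δ′ : ∀ j {e} n → suc k ℕ.+ j ≡ e → denTimes k (δ j) n ≡ δ j n - + 2 * δ (suc j) n + δ e n
  denTimes-δ′ j n refl = denTimes-δ k j n

  δ-cong : ∀ c {e e′} n → e ≡ e′ → mono c e n ≡ c * δ e′ n
  δ-cong c n refl = mono≡∙δ c _ n

  num≡∑δ : ∀ n → num k n ≡ + 8 * δ 1 n + - + 14 * δ 2 n + - + 4 * δ k n + + 2 * δ (suc k) n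
                           + + 14 * δ (2 ℕ.+ k) n + - + 2 * δ (suc (k ℕ.+ k)) n + - + 4 * δ (2 ℕ.+ (k ℕ.+ k)) n
  num≡∑δ n =
    cong₂ _+_ (cong₂ _+_ (cong₂ _+_ (cong₂ _+_ (cong₂ _+_ (cong₂ _+_
      (δ-cong (+ 8) n refl) (δ-cong (- + 14) n refl)) (δ-cong (- + 4) n refl))
      (δ-cong (+ 2) n (+-comm k 1))) (δ-cong (+ 14) n (+-comm k 2)))
      (δ-cong (- + 2) n (+-comm (k ℕ.+ k) 1))) (δ-cong (- + 4) n (+-comm (k ℕ.+ k) 2))

  denTimes-W : ∀ n → denTimes k W n ≡ num k n
  denTimes-W n = begin
    denTimes k W n
      ≡⟨ denTimes-linearCombination k W-terms n ⟩
    _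
      ≡⟨ collect (δ 1 n) (δ 2 n) (δ k n) (δ (suc k) n) (δ (2 ℕ.+ k) n) (δ (suc (k ℕ.+ k)) n) (δ (2 ℕ.+ (k ℕ.+ k)) n)
                 (denTimes-shift-A 1 n)
                 (denTimes-δ′ 1 n (cong suc (+-comm k 1)))
                 (denTimes-δ′ k n refl)
                 (denTimes-δ′ (suc k) n (cong suc (+-suc k k)))
                 (denTimes-shift-A (suc k) n)
                 (denTimes-shift-A (2 ℕ.+ k) n) ⟩
    + 8 * δ 1 n + - + 14 * δ 2 n + - + 4 * δ k n + + 2 * δ (suc k) n
      + + 14 * δ (2 ℕ.+ k) n + - + 2 * δ (suc (k ℕ.+ k)) n + - + 4 * δ (2 ℕ.+ (k ℕ.+ k)) n
      ≡⟨ num≡∑δ n ⟨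
    num k n
      ∎
    where
    open ≡-Reasoning
    collect : ∀ x₁ x₂ xₖ xₖ₊₁ xₖ₊₂ x₂ₖ₊₁ x₂ₖ₊₂ {y₁ y₂ y₃ y₄ y₅ y₆} →
      y₁ ≡ x₁ - xₖ₊₁ → y₂ ≡ x₁ - + 2 * x₂ + xₖ₊₂ → y₃ ≡ xₖ - + 2 * xₖ₊₁ + x₂ₖ₊₁ →
      y₄ ≡ xₖ₊₁ - + 2 * xₖ₊₂ + x₂ₖ₊₂ → y₅ ≡ xₖ₊₁ - x₂ₖ₊₁ → y₆ ≡ xₖ₊₂ - x₂ₖ₊₂ →
      + 1 * y₁ + (+ 7 * y₂ + (- + 4 * y₃ + (- + 3 * y₄ + (- + 2 * y₅ + (+ 1 * y₆ + 0ℤ)))))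
        ≡ + 8 * x₁ + - + 14 * x₂ + - + 4 * xₖ + + 2 * xₖ₊₁ + + 14 * xₖ₊₂ + - + 2 * x₂ₖ₊₁ + - + 4 * x₂ₖ₊₂
    collect x₁ x₂ xₖ xₖ₊₁ xₖ₊₂ x₂ₖ₊₁ x₂ₖ₊₂ refl refl refl refl refl refl =
      solve (x₁ ∷ x₂ ∷ xₖ ∷ xₖ₊₁ ∷ xₖ₊₂ ∷ x₂ₖ₊₁ ∷ x₂ₖ₊₂ ∷ [])

open import Data.Nat using (suc; z≤n; s≤s)
open import Relation.Binary.PropositionalEquality using (trans; module ≡-Reasoning)
open PowerSeries using (den-associates; ⊛-congʳ; den-⊛; denTimes)

corollary3p2 : (k : ℕ) → 2 ≤ k → (n : ℕ) → ((den k ⊛ den k) ⊛ seriesCoeff k) n ≡ num k n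
corollary3p2 (suc (suc k′)) (s≤s (s≤s z≤n)) n = begin
  ((den k ⊛ den k) ⊛ S) n   ≡⟨ den-associates k (den k) S n ⟩
  (den k ⊛ (den k ⊛ S)) n   ≡⟨ ⊛-congʳ (den k) n (λ i → trans (den-⊛ k S i) (denTimes-S i)) ⟩
  (den k ⊛ W) n             ≡⟨ den-⊛ k W n ⟩
  denTimes k W n            ≡⟨ denTimes-W n ⟩
  num k n                   ∎
  where
  open ≡-Reasoning
  open Counting k′ using (k)
  open GeneratingFunctions k′ using (S; W; denTimes-S; denTimes-W)
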